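{- Let $f,g:\{0,1\}^n\to\{0,1\}$ be two Boolean functions. If there exists $c\in\{0,1\}^n$ such that $f(x)=g(x)$ for every $x\in\{0,1\}^n$ at Hamming distance at most $\mathrm{s}(f)+\mathrm{s}(g)$ from $c$, then $f=g$.
   Context: For $x\in\{0,1\}^n$ and $i\in[n]$, $x^i$ is $x$ with the $i$-th bit flipped. The sensitivity of $f$ at $x$ is $\mathrm{s}(f,x)=|\{i\in[n]: f(x)\ne f(x^i)\}|$ and $\mathrm{s}(f)=\max_{x}\mathrm{s}(f,x)$. -}

module Defs where

open import Data.Bool using (Bool; true; false; not; _xor_)
open import Data.Bool.Properties using () renaming (_≟_ to _≟ᵇ_)
open import Data.Nat using (ℕ; zero; suc; _+_; _⊔_)
open import Data.Fin using (Fin)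
open import Data.Vec using (Vec; []; _∷_; lookup; _[_]%=_)
open import Data.List using (List; []; _∷_; map; foldr; length; filter; _++_)
open import Data.List.Base using (allFin)
open import Relation.Nullary using (¬?)

Cube : ℕ → Set
Cube n = Vec Bool n

BoolFun : ℕ → Set
BoolFun n = Cube n → Bool

flipAt : {n : ℕ} → Fin n → Cube n → Cube n
flipAt i x = x [ i ]%= not

allCube : (n : ℕ) → List (Cube n)
allCube zero = [] ∷ []
allCube (suc n) = map (false ∷_) (allCube n) ++ map (true ∷_) (allCube n)

sensAt : {n : ℕ} → BoolFun n → Cube n → ℕ
sensAt {n} f x = length (filter (λ i → ¬? (f x ≟ᵇ f (flipAt i x))) (allFin n))

sens : {n : ℕ} → BoolFun n → ℕ
sens {n} f = foldr (λ x m → sensAt f x ⊔ m) 0 (allCube n)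

hamming : {n : ℕ} → Cube n → Cube n → ℕ
hamming {n} x y = length (filter (λ i → ¬? (lookup x i ≟ᵇ lookup y i)) (allFin n))

module Submission where

-- If f and g agree on the Hamming ball of radius r ≥ s(f) + s(g) around c but differ at a point x
-- at distance r + 1, then every one of the r + 1 neighbours of x that is closer to c lies in the
-- ball, so at each of those coordinates f or g must be sensitive at x.  This forces
-- r + 1 ≤ s(f,x) + s(g,x) ≤ s(f) + s(g) ≤ r, which is absurd; hence the ball of agreement grows
-- without bound.

open import Defs
open import Data.Bool using (Bool; true; false; not)
open import Data.Bool.Properties using (¬-not) renaming (_≟_ to _≟ᵇ_)
open import Data.Nat using (ℕ; zero; suc; _+_; _≤_; _⊔_; z≤n; s≤s; s≤s⁻¹)
open import Data.Nat.Properties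
  using (≤-refl; ≤-trans; ≤-reflexive; +-suc; +-mono-≤; +-monoˡ-≤; +-monoʳ-≤;
         module ≤-Reasoning; m≤m+n; m≤n+m; n≤1+n; m≤m⊔n; m≤n⊔m; +-identityʳ; ≰⇒>; <⇒≱; _≤?_)
open import Data.Product using (∃; _,_)
open import Data.Sum using (_⊎_; inj₁; inj₂)
open import Data.Fin using (Fin)
import Data.Fin as Fin
open import Data.Vec using ([]; _∷_; lookup)
open import Data.List using (List; []; _∷_; map; foldr; length; filter; tabulate; allFin)
open import Data.List.Properties using (filter-accept; filter-reject)
open import Data.List.Membership.Propositional using (_∈_)
open import Data.List.Membership.Propositional.Properties using (∈-map⁺; ∈-++⁺ˡ; ∈-++⁺ʳ)
open import Data.List.Relation.Unary.Any using (here; there)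
open import Function using (_∘_)
open import Level using (Level)
open import Relation.Nullary using (¬?; Dec; yes; no; does; contradiction)
open import Relation.Unary using (Pred; Decidable)
open import Relation.Binary.PropositionalEquality
  using (_≡_; _≢_; refl; sym; trans; cong; ≢-sym; module ≡-Reasoning)

private
  variable
    A B : Set
    ℓ : Level
    n : ℕ

length-filter-∷ : ∀ {P : Pred A ℓ} (P? : Decidable P) x xs →
                  length (filter P? xs) ≤ length (filter P? (x ∷ xs))
length-filter-∷ P? x xs with does (P? x)
... | true  = n≤1+n _
... | false = ≤-refl

length-filter-accept : ∀ {P : Pred A ℓ} (P? : Decidable P) {x xs} → P x →
                       length (filter P? (x ∷ xs)) ≡ suc (length (filter P? xs))
length-filter-accept P? px = cong length (filter-accept P? px)

length-filter-⊆-∪ : ∀ {P Q R : Pred A ℓ} (P? : Decidable P) (Q? : Decidable Q) (R? : Decidable R) →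
                    (∀ {x} → P x → Q x ⊎ R x) → ∀ xs →
                    length (filter P? xs) ≤ length (filter Q? xs) + length (filter R? xs)
length-filter-⊆-∪ P? Q? R? P⊆Q∪R [] = z≤n
length-filter-⊆-∪ P? Q? R? P⊆Q∪R (x ∷ xs) with ih ← length-filter-⊆-∪ P? Q? R? P⊆Q∪R xs | P? x
... | no _ = begin
  length (filter P? xs)                                   ≤⟨ ih ⟩
  length (filter Q? xs) + length (filter R? xs)           ≤⟨ +-mono-≤ (length-filter-∷ Q? x xs) (length-filter-∷ R? x xs) ⟩
  length (filter Q? (x ∷ xs)) + length (filter R? (x ∷ xs)) ∎
  where open ≤-Reasoning
... | yes px with P⊆Q∪R px
...   | inj₁ qx = begin
  suc (length (filter P? xs))                                ≤⟨ s≤s ih ⟩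
  suc (length (filter Q? xs) + length (filter R? xs))        ≤⟨ s≤s (+-monoʳ-≤ _ (length-filter-∷ R? x xs)) ⟩
  suc (length (filter Q? xs)) + length (filter R? (x ∷ xs))  ≡⟨ cong (_+ _) (sym (length-filter-accept Q? qx)) ⟩
  length (filter Q? (x ∷ xs)) + length (filter R? (x ∷ xs))  ∎
  where open ≤-Reasoning
...   | inj₂ rx = begin
  suc (length (filter P? xs))                                ≤⟨ s≤s ih ⟩
  suc (length (filter Q? xs) + length (filter R? xs))        ≤⟨ s≤s (+-monoˡ-≤ _ (length-filter-∷ Q? x xs)) ⟩
  suc (length (filter Q? (x ∷ xs)) + length (filter R? xs))  ≡⟨ sym (+-suc _ _) ⟩
  length (filter Q? (x ∷ xs)) + suc (length (filter R? xs))  ≡⟨ cong (_ +_) (sym (length-filter-accept R? rx)) ⟩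
  length (filter Q? (x ∷ xs)) + length (filter R? (x ∷ xs))  ∎
  where open ≤-Reasoning

length-filter-∷-cong : ∀ {P : Pred A ℓ} {Q : Pred B ℓ} (P? : Decidable P) (Q? : Decidable Q) {x y xs ys} →
                       does (P? x) ≡ does (Q? y) → length (filter P? xs) ≡ length (filter Q? ys) →
                       length (filter P? (x ∷ xs)) ≡ length (filter Q? (y ∷ ys))
length-filter-∷-cong P? Q? {x} {y} head tail with does (P? x) | does (Q? y)
length-filter-∷-cong P? Q? refl tail | true  | true  = cong suc tail
length-filter-∷-cong P? Q? refl tail | false | false = tail

length-filter-tabulate : ∀ {P : Pred B ℓ} (P? : Decidable P) (f : Fin n → B) →
                         length (filter P? (tabulate f)) ≡ length (filter (P? ∘ f) (allFin n))
length-filter-tabulate {n = zero}  P? f = refl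
length-filter-tabulate {n = suc n} P? f = length-filter-∷-cong P? (P? ∘ f) refl (begin
  length (filter P? (tabulate (f ∘ Fin.suc)))       ≡⟨ length-filter-tabulate P? (f ∘ Fin.suc) ⟩
  length (filter (P? ∘ f ∘ Fin.suc) (allFin n))     ≡⟨ length-filter-tabulate (P? ∘ f) Fin.suc ⟨
  length (filter (P? ∘ f) (tabulate Fin.suc))       ∎)
  where open ≡-Reasoning

≤-foldr-⊔ : (h : A → ℕ) {x : A} {xs : List A} → x ∈ xs → h x ≤ foldr (λ y m → h y ⊔ m) 0 xs
≤-foldr-⊔ h {xs = y ∷ xs} (here refl) = m≤m⊔n (h y) _
≤-foldr-⊔ h {xs = y ∷ xs} (there x∈xs) = ≤-trans (≤-foldr-⊔ h x∈xs) (m≤n⊔m (h y) _)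

∈-allCube : (x : Cube n) → x ∈ allCube n
∈-allCube [] = here refl
∈-allCube {suc n} (false ∷ x) = ∈-++⁺ˡ (∈-map⁺ (false ∷_) (∈-allCube x))
∈-allCube {suc n} (true ∷ x) = ∈-++⁺ʳ (map (false ∷_) (allCube n)) (∈-map⁺ (true ∷_) (∈-allCube x))

sensAt≤sens : (f : BoolFun n) (x : Cube n) → sensAt f x ≤ sens f
sensAt≤sens f x = ≤-foldr-⊔ (sensAt f) (∈-allCube x)

hamming-∷-≡ : ∀ {a b} {x y : Cube n} → a ≡ b → hamming (a ∷ x) (b ∷ y) ≡ hamming x y
hamming-∷-≡ {a = a} {b} {x} {y} a≡b =
  trans (cong length (filter-reject mismatch? {Fin.zero} {tabulate Fin.suc} (λ a≢b → a≢b a≡b)))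
        (length-filter-tabulate mismatch? Fin.suc)
  where mismatch? = λ i → ¬? (lookup (a ∷ x) i ≟ᵇ lookup (b ∷ y) i)

hamming-∷-≢ : ∀ {a b} {x y : Cube n} → a ≢ b → hamming (a ∷ x) (b ∷ y) ≡ suc (hamming x y)
hamming-∷-≢ {a = a} {b} {x} {y} a≢b =
  trans (cong length (filter-accept mismatch? {Fin.zero} {tabulate Fin.suc} a≢b))
        (cong suc (length-filter-tabulate mismatch? Fin.suc))
  where mismatch? = λ i → ¬? (lookup (a ∷ x) i ≟ᵇ lookup (b ∷ y) i)

suc-hamming-∷ : ∀ {a b} {x x′ y : Cube n} → Dec (a ≡ b) → suc (hamming x′ y) ≡ hamming x y →
                suc (hamming (a ∷ x′) (b ∷ y)) ≡ hamming (a ∷ x) (b ∷ y)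
suc-hamming-∷ {a = a} {b} {x} {x′} {y} (yes a≡b) step = begin
  suc (hamming (a ∷ x′) (b ∷ y)) ≡⟨ cong suc (hamming-∷-≡ a≡b) ⟩
  suc (hamming x′ y)             ≡⟨ step ⟩
  hamming x y                    ≡⟨ sym (hamming-∷-≡ a≡b) ⟩
  hamming (a ∷ x) (b ∷ y)        ∎
  where open ≡-Reasoning
suc-hamming-∷ {a = a} {b} {x} {x′} {y} (no a≢b) step = begin
  suc (hamming (a ∷ x′) (b ∷ y)) ≡⟨ cong suc (hamming-∷-≢ a≢b) ⟩
  suc (suc (hamming x′ y))       ≡⟨ cong suc step ⟩
  suc (hamming x y)              ≡⟨ sym (hamming-∷-≢ a≢b) ⟩
  hamming (a ∷ x) (b ∷ y)        ∎
  where open ≡-Reasoning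

hamming-flipAt : (j : Fin n) (x c : Cube n) → lookup x j ≢ lookup c j →
                 suc (hamming (flipAt j x) c) ≡ hamming x c
hamming-flipAt Fin.zero (a ∷ x) (b ∷ c) a≢b = begin
  suc (hamming (not a ∷ x) (b ∷ c)) ≡⟨ cong suc (hamming-∷-≡ (sym (¬-not (≢-sym a≢b)))) ⟩
  suc (hamming x c)                 ≡⟨ sym (hamming-∷-≢ a≢b) ⟩
  hamming (a ∷ x) (b ∷ c)           ∎
  where open ≡-Reasoning
hamming-flipAt (Fin.suc j) (a ∷ x) (b ∷ c) xⱼ≢cⱼ = suc-hamming-∷ (a ≟ᵇ b) (hamming-flipAt j x c xⱼ≢cⱼ)

≢-≡-split : ∀ {a b a′ b′ : Bool} → a ≢ b → a′ ≡ b′ → a ≢ a′ ⊎ b ≢ b′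
≢-≡-split {a} {a′ = a′} a≢b a′≡b′ with a ≟ᵇ a′
... | yes a≡a′ = inj₂ (λ b≡b′ → a≢b (trans a≡a′ (trans a′≡b′ (sym b≡b′))))
... | no a≢a′ = inj₁ a≢a′

hamming≤sensAt+sensAt : (f g : BoolFun n) (x c : Cube n) → f x ≢ g x →
                        (∀ j → lookup x j ≢ lookup c j → f (flipAt j x) ≡ g (flipAt j x)) →
                        hamming x c ≤ sensAt f x + sensAt g x
hamming≤sensAt+sensAt {n} f g x c fx≢gx agree =
  length-filter-⊆-∪ _ _ _ (λ {j} xⱼ≢cⱼ → ≢-≡-split fx≢gx (agree j xⱼ≢cⱼ)) (allFin n)

AgreeWithin : BoolFun n → BoolFun n → Cube n → ℕ → Set
AgreeWithin f g c r = ∀ x → hamming x c ≤ r → f x ≡ g x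

agreeWithin-suc : (f g : BoolFun n) (c : Cube n) {r : ℕ} → sens f + sens g ≤ r →
                  AgreeWithin f g c r → AgreeWithin f g c (suc r)
agreeWithin-suc f g c {r} s≤r agree x d≤1+r with hamming x c ≤? r
... | yes d≤r = agree x d≤r
... | no d≰r with f x ≟ᵇ g x
...   | yes fx≡gx = fx≡gx
...   | no fx≢gx = contradiction (≤-trans d≤sensAt (≤-trans sensAt≤s s≤r)) (<⇒≱ (≰⇒> d≰r))
  where
  closer : ∀ j → lookup x j ≢ lookup c j → hamming (flipAt j x) c ≤ r
  closer j xⱼ≢cⱼ = s≤s⁻¹ (≤-trans (≤-reflexive (hamming-flipAt j x c xⱼ≢cⱼ)) d≤1+r)
  d≤sensAt = hamming≤sensAt+sensAt f g x c fx≢gx (λ j xⱼ≢cⱼ → agree (flipAt j x) (closer j xⱼ≢cⱼ))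
  sensAt≤s = +-mono-≤ (sensAt≤sens f x) (sensAt≤sens g x)

agreeWithin-+ : (f g : BoolFun n) (c : Cube n) →
                AgreeWithin f g c (sens f + sens g) → ∀ k → AgreeWithin f g c (sens f + sens g + k)
agreeWithin-+ f g c agree zero rewrite +-identityʳ (sens f + sens g) = agree
agreeWithin-+ f g c agree (suc k) rewrite +-suc (sens f + sens g) k =
  agreeWithin-suc f g c (m≤m+n _ k) (agreeWithin-+ f g c agree k)

theorem7 : (n : ℕ) (f g : BoolFun n) →
    ∃ (λ (c : Cube n) → (x : Cube n) → hamming x c ≤ sens f + sens g → f x ≡ g x) →
    (x : Cube n) → f x ≡ g x
theorem7 n f g (c , agree) x = agreeWithin-+ f g c agree (hamming x c) x (m≤n+m _ _)
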